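{- Let $r\ge 2$ and let $\mathcal{C}$ be an exact $r$-CNF formula with $m$ clauses over $x_1,\dots,x_n$ with $\mathrm{cn}(\mathcal{C})\le(2^r-2)m$. For each clause $Z$ define $X_Z$ to be $2^{ -r}$ on truth assignments satisfying $Z$ and $2^{ -r}-1$ on those not satisfying $Z$, and let $X=\sum_{Z\in\mathcal{C}}X_Z$, with the truth assignment chosen uniformly at random from $\{ -1,1\}^n$. Then $\mathbb{E}(X^2)\ge m4^{ -r}$.
   Context: Variables take values in $\{1,-1\}$ (true/false); an exact $r$-CNF formula is a set of distinct clauses each with exactly $r$ distinct literals containing no complementary pair. Two distinct clauses $Y,Z$ have a conflict if some literal $p\in Y$ has $-p\in Z$, and an overlap if they share a literal but have no conflict; $\mathrm{cn}(\mathcal{C})=c-o$ where $c$ (resp. $o$) is the number of ordered pairs of distinct clauses with a conflict (resp. overlap). -}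

module Defs where

open import Data.Nat as ℕ using (ℕ; zero; suc)
open import Data.Bool using (Bool; true; false; not; if_then_else_; _∨_)
open import Data.Fin using (Fin)
import Data.Fin.Properties as FinP
open import Data.Product using (_×_; _,_; ∃-syntax)
import Data.Product.Properties as ProdP
import Data.Bool.Properties as BoolP
open import Data.List using (List; []; _∷_; _++_; length; concatMap; foldr; map; filter)
open import Data.List.Relation.Unary.Any using (Any; any?)
open import Data.List.Relation.Unary.Unique.Propositional using (Unique)
open import Data.List.Membership.Propositional using (_∈_; _∉_)
open import Data.Vec.Functional using (Vector) renaming (_∷_ to _∷ᵛ_)
open import Relation.Nullary using (¬_; Dec; yes; no; _×-dec_; ¬?)
open import Relation.Nullary.Decidable using (⌊_⌋)
open import Relation.Binary.PropositionalEquality using (_≡_)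
open import Relation.Binary.Definitions using (DecidableEquality)
open import Data.Integer as ℤ using (ℤ)
open import Data.Rational as ℚ using (ℚ; ½)

-- A literal over variables x_0..x_{n-1}: (x , true) is the positive
-- literal x, (x , false) is the negative literal -x.
Lit : ℕ → Set
Lit n = Fin n × Bool

neg : ∀ {n} → Lit n → Lit n
neg (x , b) = (x , not b)

_≟ᴸ_ : ∀ {n} → DecidableEquality (Lit n)
_≟ᴸ_ = ProdP.≡-dec FinP._≟_ BoolP._≟_

Clause : ℕ → Set
Clause n = List (Lit n)

ExactClause : ℕ → ∀ {n} → Clause n → Set
ExactClause r {n} Y = length Y ≡ r × Unique Y × (∀ (p : Lit n) → p ∈ Y → neg p ∉ Y)

ExactCNF : ℕ → ∀ {n} → List (Clause n) → Set
ExactCNF r {n} C = Unique C × (∀ (Y : Clause n) → Y ∈ C → ExactClause r Y)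

_∈?ᴸ_ : ∀ {n} (p : Lit n) (Z : Clause n) → Dec (p ∈ Z)
p ∈?ᴸ Z = any? (p ≟ᴸ_) Z

Conflict : ∀ {n} → Clause n → Clause n → Set
Conflict Y Z = Any (λ p → neg p ∈ Z) Y

conflict? : ∀ {n} (Y Z : Clause n) → Dec (Conflict Y Z)
conflict? Y Z = any? (λ p → neg p ∈?ᴸ Z) Y

Overlap : ∀ {n} → Clause n → Clause n → Set
Overlap Y Z = Any (λ p → p ∈ Z) Y × ¬ Conflict Y Z

overlap? : ∀ {n} (Y Z : Clause n) → Dec (Overlap Y Z)
overlap? Y Z = any? (λ p → p ∈?ᴸ Z) Y ×-dec ¬? (conflict? Y Z)

orderedPairs : ∀ {A : Set} → List A → List (A × A)
orderedPairs [] = []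
orderedPairs (x ∷ xs) = concatMap (λ y → (x , y) ∷ (y , x) ∷ []) xs ++ orderedPairs xs

count : ∀ {A : Set} → (A → Bool) → List A → ℕ
count f [] = 0
count f (x ∷ xs) = (if f x then 1 else 0) ℕ.+ count f xs

conflictCount : ∀ {n} → List (Clause n) → ℕ
conflictCount C = count (λ { (Y , Z) → ⌊ conflict? Y Z ⌋ }) (orderedPairs C)

overlapCount : ∀ {n} → List (Clause n) → ℕ
overlapCount C = count (λ { (Y , Z) → ⌊ overlap? Y Z ⌋ }) (orderedPairs C)

cn : ∀ {n} → List (Clause n) → ℤ
cn C = ℤ.+ conflictCount C ℤ.- ℤ.+ overlapCount C

-- Truth assignments: true represents 1, false represents -1.
Assignment : ℕ → Set
Assignment n = Vector Bool n

allAssignments : ∀ n → List (Assignment n)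
allAssignments zero = (λ ()) ∷ []
allAssignments (suc n) =
  concatMap (λ a → (true ∷ᵛ a) ∷ (false ∷ᵛ a) ∷ []) (allAssignments n)

litSat : ∀ {n} → Assignment n → Lit n → Bool
litSat a (x , b) = ⌊ a x BoolP.≟ b ⌋

clauseSat : ∀ {n} → Assignment n → Clause n → Bool
clauseSat a Y = foldr (λ p acc → litSat a p ∨ acc) false Y

half^ : ℕ → ℚ
half^ zero = ℚ.1ℚ
half^ (suc k) = ½ ℚ.* half^ k

sumℚ : List ℚ → ℚ
sumℚ = foldr ℚ._+_ ℚ.0ℚ

XZ : ℕ → ∀ {n} → Clause n → Assignment n → ℚ
XZ r Z a = if clauseSat a Z then half^ r else half^ r ℚ.- ℚ.1ℚ

X : ℕ → ∀ {n} → List (Clause n) → Assignment n → ℚ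
X r C a = sumℚ (map (λ Z → XZ r Z a) C)

𝔼 : ∀ n → (Assignment n → ℚ) → ℚ
𝔼 n f = sumℚ (map f (allAssignments n)) ℚ.* half^ n

module Submission where

-- For an exact r-clause Z a uniform assignment falsifies Z with probability 2^-r, and expanding
-- the product gives E(X_Y X_Z) = Pr[Y ++ Z is falsified] - 4^-r.  That probability is 2^-r if
-- Y = Z, 0 if Y and Z conflict, at least 4^-r otherwise, and at least 2·4^-r if they overlap,
-- since Y ++ Z then repeats a literal.  Summing over the diagonal and the ordered pairs,
-- E(X²) ≥ m(2^-r - 4^-r) + 4^-r(o - c) ≥ m(2^-r - 4^-r) - 4^-r(2^r - 2)m = m 4^-r.
-- The probabilities come from counting: a clause of k literals without a complementary pair is
-- falsified by at least 2^(n-k) of the 2^n assignments, and by exactly 2^(n-k) when its literals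
-- are distinct; both follow by induction on n, splitting off the first variable.

module Falsifiers where

  open import Defs
  open import Data.Nat using (ℕ; zero; suc; _+_; _*_; _^_; _≤_; z≤n; s≤s)
  import Data.Nat.Properties as ℕP
  open import Data.Nat.Tactic.RingSolver using (solve-∀)
  open import Data.Bool using (Bool; true; false; not; _∨_; if_then_else_)
  import Data.Bool.Properties as BoolP
  open import Data.Fin using (zero; suc)
  open import Data.Product using (_,_; proj₁; proj₂)
  open import Data.Sum using (inj₁; inj₂; [_,_]′)
  open import Data.Empty using (⊥-elim)
  open import Data.List using (List; []; _∷_; _++_; length; concatMap; foldr)
  import Data.List.Properties as ListP
  open import Data.List.Relation.Unary.Any using (Any; here; there)
  open import Data.List.Relation.Unary.All using (_∷_)
  open import Data.List.Relation.Unary.All.Properties.Core using (¬Any⇒All¬; All¬⇒¬Any)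
  open import Data.List.Relation.Unary.AllPairs using ([]; _∷_)
  open import Data.List.Relation.Unary.Unique.Propositional using (Unique)
  open import Data.List.Membership.Propositional using (_∈_; _∉_; find; lose)
  open import Data.List.Membership.Propositional.Properties using (∈-++⁻; ∈-++⁺ˡ; ∈-++⁺ʳ; ∈-∃++)
  open import Data.List.Relation.Binary.Subset.Propositional using (_⊆_)
  open import Data.List.Relation.Binary.Subset.Propositional.Properties using (Any-resp-⊆; xs⊆x∷xs; ++⁺ʳ; xs⊆xs++ys)
  open import Data.Vec.Functional using () renaming (_∷_ to _∷ᵛ_)
  open import Function using (_∘_; id)
  open import Function.Bundles using (mk⇔)
  open import Relation.Nullary using (¬_; yes; no)
  open import Relation.Nullary.Decidable using (⌊_⌋)
  open import Relation.Binary.PropositionalEquality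

  count-cong : ∀ {A : Set} {f g : A → Bool} → (∀ x → f x ≡ g x) → ∀ xs → count f xs ≡ count g xs
  count-cong f≗g [] = refl
  count-cong f≗g (x ∷ xs) rewrite f≗g x | count-cong f≗g xs = refl

  count-const-false : ∀ {A : Set} (xs : List A) → count (λ _ → false) xs ≡ 0
  count-const-false [] = refl
  count-const-false (x ∷ xs) = count-const-false xs

  count-allAssignments-suc : ∀ n (P : Assignment (suc n) → Bool) →
    count P (allAssignments (suc n)) ≡
    count (λ a → P (true ∷ᵛ a)) (allAssignments n) + count (λ a → P (false ∷ᵛ a)) (allAssignments n)
  count-allAssignments-suc n P = go (allAssignments n)
    where
    interchange : ∀ x y u v → x + (y + (u + v)) ≡ (x + u) + (y + v)
    interchange = solve-∀
    go : ∀ as → count P (concatMap (λ a → (true ∷ᵛ a) ∷ (false ∷ᵛ a) ∷ []) as) ≡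
                count (λ a → P (true ∷ᵛ a)) as + count (λ a → P (false ∷ᵛ a)) as
    go [] = refl
    go (a ∷ as) rewrite go as = interchange (if P (true ∷ᵛ a) then 1 else 0) (if P (false ∷ᵛ a) then 1 else 0) _ _

  count-allAssignments-true : ∀ n → count (λ _ → true) (allAssignments n) ≡ 2 ^ n
  count-allAssignments-true zero = refl
  count-allAssignments-true (suc n)
    rewrite count-allAssignments-suc n (λ _ → true) | count-allAssignments-true n = cong (2 ^ n +_) (sym (ℕP.+-identityʳ _))

  Consistent : ∀ {n} → Clause n → Set
  Consistent {n} L = ∀ (p : Lit n) → p ∈ L → neg p ∉ L

  falsifiers : ∀ n → Clause n → ℕ
  falsifiers n L = count (λ a → not (clauseSat a L)) (allAssignments n)

  clauseSat⁺ : ∀ {n} (a : Assignment n) {L} → Any (λ p → litSat a p ≡ true) L → clauseSat a L ≡ true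
  clauseSat⁺ a (here sat) rewrite sat = refl
  clauseSat⁺ a {p ∷ L} (there sat) rewrite clauseSat⁺ a sat = BoolP.∨-zeroʳ (litSat a p)

  clauseSat⁻ : ∀ {n} (a : Assignment n) L → clauseSat a L ≡ true → Any (λ p → litSat a p ≡ true) L
  clauseSat⁻ a (p ∷ L) sat with litSat a p in eq
  ... | true = here eq
  ... | false = there (clauseSat⁻ a L sat)

  clauseSat-⊆ : ∀ {n} (a : Assignment n) {L L′} → L ⊆ L′ → clauseSat a L ≡ true → clauseSat a L′ ≡ true
  clauseSat-⊆ a {L} L⊆L′ sat = clauseSat⁺ a (Any-resp-⊆ L⊆L′ (clauseSat⁻ a L sat))

  falsifiers-cong : ∀ n {L L′ : Clause n} → L ⊆ L′ → L′ ⊆ L → falsifiers n L ≡ falsifiers n L′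
  falsifiers-cong n L⊆L′ L′⊆L = count-cong
    (λ a → cong not (BoolP.⇔→≡ (mk⇔ (clauseSat-⊆ a L⊆L′) (clauseSat-⊆ a L′⊆L))))
    (allAssignments n)

  litSat-neg : ∀ {n} (a : Assignment n) p → litSat a (neg p) ≡ not (litSat a p)
  litSat-neg a (x , b) with a x
  litSat-neg a (x , true) | true = refl
  litSat-neg a (x , false) | true = refl
  litSat-neg a (x , true) | false = refl
  litSat-neg a (x , false) | false = refl

  falsifiers-complementary : ∀ n {L : Clause n} {p} → p ∈ L → neg p ∈ L → falsifiers n L ≡ 0
  falsifiers-complementary n {L} {p} p∈L ¬p∈L =
    trans (count-cong (λ a → cong not (sat a)) (allAssignments n)) (count-const-false (allAssignments n))
    where
    sat : ∀ a → clauseSat a L ≡ true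
    sat a with litSat a p in eq
    ... | true = clauseSat⁺ a (lose p∈L eq)
    ... | false = clauseSat⁺ a (lose ¬p∈L (trans (litSat-neg a p) (cong not eq)))

  headSigns : ∀ {n} → Clause (suc n) → List Bool
  headSigns [] = []
  headSigns ((zero , b) ∷ L) = b ∷ headSigns L
  headSigns ((suc _ , _) ∷ L) = headSigns L

  tailLits : ∀ {n} → Clause (suc n) → Clause n
  tailLits [] = []
  tailLits ((zero , _) ∷ L) = tailLits L
  tailLits ((suc x , b) ∷ L) = (x , b) ∷ tailLits L

  occurs : Bool → List Bool → Bool
  occurs c = foldr (λ b acc → ⌊ c BoolP.≟ b ⌋ ∨ acc) false

  occurs-∈ : ∀ c bs → c ∈ bs → occurs c bs ≡ true
  occurs-∈ true (b ∷ bs) (here refl) = refl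
  occurs-∈ false (b ∷ bs) (here refl) = refl
  occurs-∈ c (b ∷ bs) (there i) rewrite occurs-∈ c bs i = BoolP.∨-zeroʳ _

  occurs-∉ : ∀ c bs → c ∉ bs → occurs c bs ≡ false
  occurs-∉ c [] _ = refl
  occurs-∉ c (b ∷ bs) c∉ with c BoolP.≟ b
  ... | yes refl = ⊥-elim (c∉ (here refl))
  ... | no _ = occurs-∉ c bs (c∉ ∘ there)

  clauseSat-∷ᵛ : ∀ {n} c (a : Assignment n) L →
    clauseSat (c ∷ᵛ a) L ≡ occurs c (headSigns L) ∨ clauseSat a (tailLits L)
  clauseSat-∷ᵛ c a [] = refl
  clauseSat-∷ᵛ c a ((zero , b) ∷ L) rewrite clauseSat-∷ᵛ c a L =
    sym (BoolP.∨-assoc ⌊ c BoolP.≟ b ⌋ (occurs c (headSigns L)) (clauseSat a (tailLits L)))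
  clauseSat-∷ᵛ c a ((suc x , b) ∷ L) rewrite clauseSat-∷ᵛ c a L =
    swap (litSat a (x , b)) (occurs c (headSigns L)) (clauseSat a (tailLits L))
    where
    swap : ∀ x y z → x ∨ (y ∨ z) ≡ y ∨ (x ∨ z)
    swap x y z = trans (sym (BoolP.∨-assoc x y z)) (trans (cong (_∨ z) (BoolP.∨-comm x y)) (BoolP.∨-assoc y x z))

  length-headSigns-tailLits : ∀ {n} (L : Clause (suc n)) → length L ≡ length (headSigns L) + length (tailLits L)
  length-headSigns-tailLits [] = refl
  length-headSigns-tailLits ((zero , b) ∷ L) = cong suc (length-headSigns-tailLits L)
  length-headSigns-tailLits ((suc x , b) ∷ L) = trans (cong suc (length-headSigns-tailLits L)) (sym (ℕP.+-suc _ _))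

  ∈-headSigns⁻ : ∀ {n b} (L : Clause (suc n)) → b ∈ headSigns L → (zero , b) ∈ L
  ∈-headSigns⁻ ((zero , b) ∷ L) (here refl) = here refl
  ∈-headSigns⁻ ((zero , b) ∷ L) (there i) = there (∈-headSigns⁻ L i)
  ∈-headSigns⁻ ((suc x , b) ∷ L) i = there (∈-headSigns⁻ L i)

  ∈-tailLits⁻ : ∀ {n x b} (L : Clause (suc n)) → (x , b) ∈ tailLits L → (suc x , b) ∈ L
  ∈-tailLits⁻ ((zero , b) ∷ L) i = there (∈-tailLits⁻ L i)
  ∈-tailLits⁻ ((suc x , b) ∷ L) (here refl) = here refl
  ∈-tailLits⁻ ((suc x , b) ∷ L) (there i) = there (∈-tailLits⁻ L i)

  tailLits-consistent : ∀ {n} (L : Clause (suc n)) → Consistent L → Consistent (tailLits L)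
  tailLits-consistent L cons (x , b) i j = cons (suc x , b) (∈-tailLits⁻ L i) (∈-tailLits⁻ L j)

  tailLits-unique : ∀ {n} (L : Clause (suc n)) → Unique L → Unique (tailLits L)
  tailLits-unique [] u = []
  tailLits-unique ((zero , b) ∷ L) (_ ∷ u) = tailLits-unique L u
  tailLits-unique ((suc x , b) ∷ L) (fresh ∷ u) =
    ¬Any⇒All¬ (tailLits L) (λ i → All¬⇒¬Any fresh (∈-tailLits⁻ L i)) ∷ tailLits-unique L u

  headSigns-unique : ∀ {n} (L : Clause (suc n)) → Unique L → Unique (headSigns L)
  headSigns-unique [] u = []
  headSigns-unique ((suc x , b) ∷ L) (_ ∷ u) = headSigns-unique L u
  headSigns-unique ((zero , b) ∷ L) (fresh ∷ u) =
    ¬Any⇒All¬ (headSigns L) (λ i → All¬⇒¬Any fresh (∈-headSigns⁻ L i)) ∷ headSigns-unique L u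

  2^length-split : ∀ {n} (L : Clause (suc n)) {bs} → headSigns L ≡ bs →
    2 ^ length L ≡ 2 ^ length bs * 2 ^ length (tailLits L)
  2^length-split L refl =
    trans (cong (2 ^_) (length-headSigns-tailLits L)) (ℕP.^-distribˡ-+-* 2 (length (headSigns L)) _)

  headSigns-consistent : ∀ {n} (L : Clause (suc n)) → Consistent L → ∀ b → b ∈ headSigns L → not b ∉ headSigns L
  headSigns-consistent L cons b i j = cons (zero , b) (∈-headSigns⁻ L i) (∈-headSigns⁻ L j)

  -- Two distinct Booleans are complementary.
  length-unique-complementFree : ∀ {bs : List Bool} → Unique bs → (∀ b → b ∈ bs → not b ∉ bs) → length bs ≤ 1
  length-unique-complementFree {[]} _ _ = z≤n
  length-unique-complementFree {_ ∷ []} _ _ = s≤s z≤n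
  length-unique-complementFree {b ∷ b′ ∷ _} ((b≢b′ ∷ _) ∷ _) free =
    ⊥-elim (free b (here refl) (there (here (sym (BoolP.¬-not (b≢b′ ∘ sym))))))

  falsifiersWithHead : ∀ n → Bool → Clause (suc n) → ℕ
  falsifiersWithHead n c L = count (λ a → not (clauseSat (c ∷ᵛ a) L)) (allAssignments n)

  falsifiersWithHead-∈ : ∀ n {c} (L : Clause (suc n)) → c ∈ headSigns L → falsifiersWithHead n c L ≡ 0
  falsifiersWithHead-∈ n {c} L c∈ = trans
    (count-cong (λ a → cong not (trans (clauseSat-∷ᵛ c a L) (cong (_∨ _) (occurs-∈ c _ c∈)))) (allAssignments n))
    (count-const-false (allAssignments n))

  falsifiersWithHead-∉ : ∀ n {c} (L : Clause (suc n)) → c ∉ headSigns L →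
    falsifiersWithHead n c L ≡ falsifiers n (tailLits L)
  falsifiersWithHead-∉ n {c} L c∉ =
    count-cong (λ a → cong not (trans (clauseSat-∷ᵛ c a L) (cong (_∨ _) (occurs-∉ c _ c∉)))) (allAssignments n)

  falsifierWeight : ∀ n → Clause n → ℕ
  falsifierWeight n L = 2 ^ length L * falsifiers n L

  falsifierWeight-suc-[] : ∀ n (L : Clause (suc n)) → headSigns L ≡ [] →
    falsifierWeight (suc n) L ≡ 2 * falsifierWeight n (tailLits L)
  falsifierWeight-suc-[] n L eq = begin
    2 ^ length L * falsifiers (suc n) L
      ≡⟨ cong₂ _*_ (2^length-split L eq) (count-allAssignments-suc n (λ a → not (clauseSat a L))) ⟩
    (1 * 2 ^ length T) * (falsifiersWithHead n true L + falsifiersWithHead n false L)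
      ≡⟨ cong ((1 * 2 ^ length T) *_)
              (cong₂ _+_ (falsifiersWithHead-∉ n L (∉[] true)) (falsifiersWithHead-∉ n L (∉[] false))) ⟩
    (1 * 2 ^ length T) * (falsifiers n T + falsifiers n T)
      ≡⟨ shuffle (2 ^ length T) (falsifiers n T) ⟩
    2 * (2 ^ length T * falsifiers n T) ∎
    where
    open ≡-Reasoning
    T = tailLits L
    ∉[] : ∀ c → c ∉ headSigns L
    ∉[] c rewrite eq = λ ()
    shuffle : ∀ x y → (1 * x) * (y + y) ≡ 2 * (x * y)
    shuffle = solve-∀

  falsifierWeight-suc-∷ : ∀ n (L : Clause (suc n)) → Consistent L → ∀ {b bs} → headSigns L ≡ b ∷ bs →
    falsifierWeight (suc n) L ≡ 2 ^ suc (length bs) * falsifierWeight n (tailLits L)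
  falsifierWeight-suc-∷ n L cons {b} {bs} eq = begin
    2 ^ length L * falsifiers (suc n) L
      ≡⟨ cong₂ _*_ (2^length-split L eq) (count-allAssignments-suc n (λ a → not (clauseSat a L))) ⟩
    (2 ^ suc (length bs) * 2 ^ length T) * (falsifiersWithHead n true L + falsifiersWithHead n false L)
      ≡⟨ cong ((2 ^ suc (length bs) * 2 ^ length T) *_) (oneSideFalsifies b (subst (b ∈_) (sym eq) (here refl))) ⟩
    (2 ^ suc (length bs) * 2 ^ length T) * falsifiers n T
      ≡⟨ ℕP.*-assoc (2 ^ suc (length bs)) (2 ^ length T) (falsifiers n T) ⟩
    2 ^ suc (length bs) * (2 ^ length T * falsifiers n T) ∎
    where
    open ≡-Reasoning
    T = tailLits L
    oneSideFalsifies : ∀ b → b ∈ headSigns L → falsifiersWithHead n true L + falsifiersWithHead n false L ≡ falsifiers n T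
    oneSideFalsifies true b∈ =
      cong₂ _+_ (falsifiersWithHead-∈ n L b∈) (falsifiersWithHead-∉ n L (headSigns-consistent L cons true b∈))
    oneSideFalsifies false b∈ = trans
      (cong₂ _+_ (falsifiersWithHead-∉ n L (headSigns-consistent L cons false b∈)) (falsifiersWithHead-∈ n L b∈))
      (ℕP.+-identityʳ (falsifiers n T))

  2≤2^suc : ∀ k → 2 ≤ 2 ^ suc k
  2≤2^suc k = ℕP.*-monoʳ-≤ 2 (ℕP.m^n>0 2 k)

  falsifierWeight-lower : ∀ n (L : Clause n) → Consistent L → 2 ^ n ≤ falsifierWeight n L
  falsifierWeight-lower zero [] _ = s≤s z≤n
  falsifierWeight-lower zero ((() , _) ∷ _) _
  falsifierWeight-lower (suc n) L cons with headSigns L in eq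
  ... | [] = begin
    2 * 2 ^ n                           ≤⟨ ℕP.*-monoʳ-≤ 2 (falsifierWeight-lower n T (tailLits-consistent L cons)) ⟩
    2 * falsifierWeight n T             ≡⟨ sym (falsifierWeight-suc-[] n L eq) ⟩
    falsifierWeight (suc n) L           ∎
    where
    open ℕP.≤-Reasoning
    T = tailLits L
  ... | b ∷ bs = begin
    2 * 2 ^ n                           ≤⟨ ℕP.*-monoʳ-≤ 2 (falsifierWeight-lower n T (tailLits-consistent L cons)) ⟩
    2 * falsifierWeight n T             ≤⟨ ℕP.*-monoˡ-≤ (falsifierWeight n T) (2≤2^suc (length bs)) ⟩
    2 ^ suc (length bs) * falsifierWeight n T ≡⟨ sym (falsifierWeight-suc-∷ n L cons eq) ⟩
    falsifierWeight (suc n) L           ∎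
    where
    open ℕP.≤-Reasoning
    T = tailLits L

  falsifierWeight-exact : ∀ n (L : Clause n) → Consistent L → Unique L → falsifierWeight n L ≡ 2 ^ n
  falsifierWeight-exact zero [] _ _ = refl
  falsifierWeight-exact zero ((() , _) ∷ _) _ _
  falsifierWeight-exact (suc n) L cons uniq with headSigns L in eq
  ... | [] = trans (falsifierWeight-suc-[] n L eq) (cong (2 *_) tailExact)
    where tailExact = falsifierWeight-exact n (tailLits L) (tailLits-consistent L cons) (tailLits-unique L uniq)
  ... | _ ∷ [] = trans (falsifierWeight-suc-∷ n L cons eq) (cong (2 *_) tailExact)
    where tailExact = falsifierWeight-exact n (tailLits L) (tailLits-consistent L cons) (tailLits-unique L uniq)
  ... | _ ∷ _ ∷ _ with s≤s () ← subst (λ bs → length bs ≤ 1) eq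
    (length-unique-complementFree (headSigns-unique L uniq) (headSigns-consistent L cons))

  consistent-⊆ : ∀ {n} {L L′ : Clause n} → L ⊆ L′ → Consistent L′ → Consistent L
  consistent-⊆ L⊆L′ cons p i j = cons p (L⊆L′ i) (L⊆L′ j)

  neg-involutive : ∀ {n} (p : Lit n) → neg (neg p) ≡ p
  neg-involutive (x , b) = cong (x ,_) (BoolP.not-involutive b)

  consistent-++ : ∀ {n} {Y Z : Clause n} → Consistent Y → Consistent Z → ¬ Conflict Y Z → Consistent (Y ++ Z)
  consistent-++ {Y = Y} {Z} consY consZ noConflict p i j with ∈-++⁻ Y i | ∈-++⁻ Y j
  ... | inj₁ i′ | inj₁ j′ = consY p i′ j′
  ... | inj₂ i′ | inj₂ j′ = consZ p i′ j′
  ... | inj₁ i′ | inj₂ j′ = noConflict (lose i′ j′)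
  ... | inj₂ i′ | inj₁ j′ = noConflict (lose j′ (subst (_∈ Z) (sym (neg-involutive p)) i′))

  falsifierWeight-repeated : ∀ n (W V : Clause n) {p} → p ∈ W → Consistent (W ++ p ∷ V) →
    2 * 2 ^ n ≤ falsifierWeight n (W ++ p ∷ V)
  falsifierWeight-repeated n W V {p} p∈W cons = begin
    2 * 2 ^ n
      ≤⟨ ℕP.*-monoʳ-≤ 2 (falsifierWeight-lower n (W ++ V) (consistent-⊆ shorter⊆ cons)) ⟩
    2 * (2 ^ length (W ++ V) * falsifiers n (W ++ V))
      ≡⟨ sym (ℕP.*-assoc 2 (2 ^ length (W ++ V)) _) ⟩
    2 ^ suc (length (W ++ V)) * falsifiers n (W ++ V)
      ≡⟨ cong₂ (λ k f → 2 ^ k * f) (sym (ListP.length-++-sucʳ W p V)) (falsifiers-cong n shorter⊆ longer⊆) ⟩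
    falsifierWeight n (W ++ p ∷ V) ∎
    where
    open ℕP.≤-Reasoning
    shorter⊆ : W ++ V ⊆ W ++ p ∷ V
    shorter⊆ = ++⁺ʳ W (xs⊆x∷xs V p)
    longer⊆ : W ++ p ∷ V ⊆ W ++ V
    longer⊆ q∈ with ∈-++⁻ W q∈
    ... | inj₁ q∈W = ∈-++⁺ˡ q∈W
    ... | inj₂ (here refl) = ∈-++⁺ˡ p∈W
    ... | inj₂ (there q∈V) = ∈-++⁺ʳ W q∈V

  module _ {r n : ℕ} {Y Z : Clause n} (exactY : ExactClause r Y) (exactZ : ExactClause r Z) where

    private
      length-Y++Z : length (Y ++ Z) ≡ r + r
      length-Y++Z = trans (ListP.length-++ Y) (cong₂ _+_ (proj₁ exactY) (proj₁ exactZ))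

      at-length-Y++Z : ∀ {k} → k ≤ falsifierWeight n (Y ++ Z) → k ≤ 2 ^ (r + r) * falsifiers n (Y ++ Z)
      at-length-Y++Z {k} = subst (λ l → k ≤ 2 ^ l * falsifiers n (Y ++ Z)) length-Y++Z

      consistent-Y++Z : ¬ Conflict Y Z → Consistent (Y ++ Z)
      consistent-Y++Z = consistent-++ (proj₂ (proj₂ exactY)) (proj₂ (proj₂ exactZ))

    falsifiers-noConflict : ¬ Conflict Y Z → 2 ^ n ≤ 2 ^ (r + r) * falsifiers n (Y ++ Z)
    falsifiers-noConflict noConflict = at-length-Y++Z (falsifierWeight-lower n (Y ++ Z) (consistent-Y++Z noConflict))

    falsifiers-overlap : Overlap Y Z → 2 * 2 ^ n ≤ 2 ^ (r + r) * falsifiers n (Y ++ Z)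
    falsifiers-overlap (shared , noConflict) with find shared
    ... | p , p∈Y , p∈Z with ∈-∃++ p∈Z
    ...   | Z₁ , Z₂ , refl = at-length-Y++Z (subst (λ L → 2 * 2 ^ n ≤ falsifierWeight n L) reassoc
      (falsifierWeight-repeated n (Y ++ Z₁) Z₂ (∈-++⁺ˡ p∈Y) (subst Consistent (sym reassoc) (consistent-Y++Z noConflict))))
      where
      reassoc : (Y ++ Z₁) ++ p ∷ Z₂ ≡ Y ++ Z
      reassoc = ListP.++-assoc Y Z₁ (p ∷ Z₂)

  falsifiers-exactClause : ∀ {r n} {Y : Clause n} → ExactClause r Y → 2 ^ r * falsifiers n Y ≡ 2 ^ n
  falsifiers-exactClause {n = n} {Y} (length≡r , uniq , cons) =
    subst (λ k → 2 ^ k * falsifiers n Y ≡ 2 ^ n) length≡r (falsifierWeight-exact n Y cons uniq)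

  falsifiers-++-self : ∀ n (Y : Clause n) → falsifiers n (Y ++ Y) ≡ falsifiers n Y
  falsifiers-++-self n Y = falsifiers-cong n (λ i → [ id , id ]′ (∈-++⁻ Y i)) (xs⊆xs++ys Y Y)

  falsifiers-conflict : ∀ n {Y Z : Clause n} → Conflict Y Z → falsifiers n (Y ++ Z) ≡ 0
  falsifiers-conflict n {Y} conflict with find conflict
  ... | p , p∈Y , ¬p∈Z = falsifiers-complementary n (∈-++⁺ˡ p∈Y) (∈-++⁺ʳ Y ¬p∈Z)

module SecondMoment where

  open import Defs
  open Falsifiers
  open import Data.Nat as ℕ using (ℕ; zero; suc; _+_; _*_; _^_; _∸_; _≤_; z≤n; s≤s)
  import Data.Nat.Properties as ℕP
  open import Data.Nat.Divisibility using (∣1⇒≡1)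
  import Data.Integer as ℤ
  open import Data.Integer using () renaming (+_ to pos)
  import Data.Integer.Properties as ℤP
  import Data.Integer.Tactic.RingSolver as ℤSolver
  open import Data.Rational as ℚ using (ℚ; 0ℚ; 1ℚ; ½; _/_)
  import Data.Rational.Properties as ℚP
  open import Data.Rational.Solver using (module +-*-Solver)
  open import Data.Bool using (Bool; true; false; not; _∨_; if_then_else_)
  import Data.Bool.Properties as BoolP
  open import Data.Product using (_×_; _,_; proj₁; proj₂; map; uncurry)
  open import Data.Sum using (inj₁; inj₂)
  open import Data.List as List using (List; []; _∷_; _++_; length; concatMap)
  open import Data.List.Relation.Unary.Any using (here; there; any?)
  open import Data.List.Membership.Propositional using (_∈_)
  open import Data.List.Membership.Propositional.Properties using (∈-++⁻)
  open import Data.List.Relation.Binary.Subset.Propositional using (_⊆_)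
  open import Function using (_∘_)
  open import Relation.Nullary using (¬_; yes; no)
  open import Relation.Nullary.Decidable using (⌊_⌋)
  open import Relation.Binary.PropositionalEquality

  ∈-orderedPairs⁻ : ∀ {A : Set} (xs : List A) {y z} → (y , z) ∈ orderedPairs xs → y ∈ xs × z ∈ xs
  ∈-orderedPairs⁻ (x ∷ xs) i with ∈-++⁻ (concatMap (λ y → (x , y) ∷ (y , x) ∷ []) xs) i
  ... | inj₁ j = withHead xs j
    where
    withHead : ∀ ys {y z} → (y , z) ∈ concatMap (λ y → (x , y) ∷ (y , x) ∷ []) ys → y ∈ x ∷ ys × z ∈ x ∷ ys
    withHead (y ∷ ys) (here refl) = here refl , there (here refl)
    withHead (y ∷ ys) (there (here refl)) = there (here refl) , here refl
    withHead (y ∷ ys) (there (there j)) = map skip skip (withHead ys j)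
      where
      skip : x ∷ ys ⊆ x ∷ y ∷ ys
      skip (here e) = here e
      skip (there k) = there (there k)
  ... | inj₂ j with ∈-orderedPairs⁻ xs j
  ...   | y∈ , z∈ = there y∈ , there z∈

  m-n≤o⇒m≤n+o : ∀ m n o → pos m ℤ.- pos n ℤ.≤ pos o → m ≤ n + o
  m-n≤o⇒m≤n+o m n o m-n≤o = ℤP.drop‿+≤+ (subst₂ ℤ._≤_ (cancel (pos m) (pos n)) o+n≡n+o (ℤP.+-monoˡ-≤ (pos n) m-n≤o))
    where
    cancel : ∀ x y → (x ℤ.- y) ℤ.+ y ≡ x
    cancel = ℤSolver.solve-∀
    o+n≡n+o : pos o ℤ.+ pos n ≡ pos (n + o)
    o+n≡n+o = sym (trans (ℤP.pos-+ n o) (ℤP.+-comm (pos n) (pos o)))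

  fromℕ : ℕ → ℚ
  fromℕ k = pos k / 1

  -- Once fromℕ k is replaced by its normal form, ℚ._+_ computes to the numerator below.
  fromℕ-suc : ∀ k → fromℕ (suc k) ≡ 1ℚ ℚ.+ fromℕ k
  fromℕ-suc k = trans (cong (_/ 1) numerator) (cong (1ℚ ℚ.+_) (sym normalized))
    where
    normalized : fromℕ k ≡ ℚ.mkℚ (pos k) 0 (λ { (_ , d∣1) → ∣1⇒≡1 d∣1 })
    normalized = ℚP.normalize-coprime _
    numerator : pos (suc k) ≡ pos 1 ℤ.* pos 1 ℤ.+ pos k ℤ.* pos 1
    numerator = cong (ℤ._+_ (pos 1)) (sym (ℤP.*-identityʳ (pos k)))

  fromℕ-+ : ∀ a b → fromℕ (a + b) ≡ fromℕ a ℚ.+ fromℕ b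
  fromℕ-+ zero b = sym (ℚP.+-identityˡ (fromℕ b))
  fromℕ-+ (suc a) b rewrite fromℕ-suc (a + b) | fromℕ-+ a b | fromℕ-suc a = sym (ℚP.+-assoc 1ℚ (fromℕ a) (fromℕ b))

  fromℕ-* : ∀ a b → fromℕ (a * b) ≡ fromℕ a ℚ.* fromℕ b
  fromℕ-* zero b = sym (ℚP.*-zeroˡ (fromℕ b))
  fromℕ-* (suc a) b rewrite fromℕ-+ b (a * b) | fromℕ-* a b | fromℕ-suc a =
    sym (trans (ℚP.*-distribʳ-+ (fromℕ b) 1ℚ (fromℕ a)) (cong (ℚ._+ (fromℕ a ℚ.* fromℕ b)) (ℚP.*-identityˡ (fromℕ b))))

  fromℕ-nonNeg : ∀ k → 0ℚ ℚ.≤ fromℕ k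
  fromℕ-nonNeg zero = ℚP.≤-refl
  fromℕ-nonNeg (suc k) rewrite fromℕ-suc k = ℚP.+-mono-≤ {0ℚ} {1ℚ} (ℚ.*≤* (ℤ.+≤+ z≤n)) (fromℕ-nonNeg k)

  fromℕ-mono-≤ : ∀ {a b} → a ≤ b → fromℕ a ℚ.≤ fromℕ b
  fromℕ-mono-≤ {a} {b} a≤b = begin
    fromℕ a                     ≡⟨ sym (ℚP.+-identityʳ (fromℕ a)) ⟩
    fromℕ a ℚ.+ 0ℚ              ≤⟨ ℚP.+-monoʳ-≤ (fromℕ a) (fromℕ-nonNeg (b ∸ a)) ⟩
    fromℕ a ℚ.+ fromℕ (b ∸ a)   ≡⟨ sym (fromℕ-+ a (b ∸ a)) ⟩
    fromℕ (a + (b ∸ a))         ≡⟨ cong fromℕ (ℕP.m+[n∸m]≡n a≤b) ⟩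
    fromℕ b                     ∎
    where open ℚP.≤-Reasoning

  fromℕ-∸ : ∀ {a b} → b ≤ a → fromℕ (a ∸ b) ≡ fromℕ a ℚ.- fromℕ b
  fromℕ-∸ {a} {b} b≤a = begin
    fromℕ (a ∸ b)                          ≡⟨ solve 2 (λ x y → x := (x :+ y) :- y) refl (fromℕ (a ∸ b)) (fromℕ b) ⟩
    (fromℕ (a ∸ b) ℚ.+ fromℕ b) ℚ.- fromℕ b ≡⟨ cong (ℚ._- fromℕ b) (sym (fromℕ-+ (a ∸ b) b)) ⟩
    fromℕ (a ∸ b + b) ℚ.- fromℕ b           ≡⟨ cong (λ x → fromℕ x ℚ.- fromℕ b) (ℕP.m∸n+n≡m b≤a) ⟩
    fromℕ a ℚ.- fromℕ b                     ∎
    where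
    open ≡-Reasoning
    open +-*-Solver

  half^-nonNeg : ∀ k → ℚ.NonNegative (half^ k)
  half^-nonNeg zero = _
  half^-nonNeg (suc k) = ℚP.nonNeg*nonNeg⇒nonNeg ½ (half^ k) {{half^-nonNeg k}}

  half^-*-2^ : ∀ k → half^ k ℚ.* fromℕ (2 ^ k) ≡ 1ℚ
  half^-*-2^ zero = refl
  half^-*-2^ (suc k) rewrite fromℕ-* 2 (2 ^ k) =
    trans (interchange ½ (half^ k) (fromℕ 2) (fromℕ (2 ^ k))) (cong (½ ℚ.* fromℕ 2 ℚ.*_) (half^-*-2^ k))
    where
    open +-*-Solver
    interchange : ∀ a b c d → (a ℚ.* b) ℚ.* (c ℚ.* d) ≡ (a ℚ.* c) ℚ.* (b ℚ.* d)
    interchange = solve 4 (λ a b c d → (a :* b) :* (c :* d) := (a :* c) :* (b :* d)) refl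

  fromℕ-*-2^-half^ : ∀ c k → fromℕ (c * 2 ^ k) ℚ.* half^ k ≡ fromℕ c
  fromℕ-*-2^-half^ c k = begin
    fromℕ (c * 2 ^ k) ℚ.* half^ k            ≡⟨ cong (ℚ._* half^ k) (fromℕ-* c (2 ^ k)) ⟩
    fromℕ c ℚ.* fromℕ (2 ^ k) ℚ.* half^ k    ≡⟨ ℚP.*-assoc (fromℕ c) _ _ ⟩
    fromℕ c ℚ.* (fromℕ (2 ^ k) ℚ.* half^ k)  ≡⟨ cong (fromℕ c ℚ.*_) (trans (ℚP.*-comm _ (half^ k)) (half^-*-2^ k)) ⟩
    fromℕ c ℚ.* 1ℚ                           ≡⟨ ℚP.*-identityʳ (fromℕ c) ⟩
    fromℕ c                                  ∎
    where open ≡-Reasoning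

  half^-scale-≤ : ∀ {c k u n} → c * 2 ^ n ≤ 2 ^ k * u → fromℕ c ℚ.* half^ k ℚ.≤ fromℕ u ℚ.* half^ n
  half^-scale-≤ {c} {k} {u} {n} c2ⁿ≤2ᵏu = begin
    fromℕ c ℚ.* half^ k                             ≡⟨ cong (ℚ._* half^ k) (sym (fromℕ-*-2^-half^ c n)) ⟩
    fromℕ (c * 2 ^ n) ℚ.* half^ n ℚ.* half^ k      ≡⟨ ℚP.*-assoc (fromℕ (c * 2 ^ n)) _ _ ⟩
    fromℕ (c * 2 ^ n) ℚ.* (half^ n ℚ.* half^ k)
      ≤⟨ ℚP.*-monoʳ-≤-nonNeg (half^ n ℚ.* half^ k) {{hh}} (fromℕ-mono-≤ (subst (c * 2 ^ n ≤_) (ℕP.*-comm (2 ^ k) u) c2ⁿ≤2ᵏu)) ⟩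
    fromℕ (u * 2 ^ k) ℚ.* (half^ n ℚ.* half^ k)    ≡⟨ cong (fromℕ (u * 2 ^ k) ℚ.*_) (ℚP.*-comm (half^ n) (half^ k)) ⟩
    fromℕ (u * 2 ^ k) ℚ.* (half^ k ℚ.* half^ n)    ≡⟨ sym (ℚP.*-assoc (fromℕ (u * 2 ^ k)) _ _) ⟩
    fromℕ (u * 2 ^ k) ℚ.* half^ k ℚ.* half^ n      ≡⟨ cong (ℚ._* half^ n) (fromℕ-*-2^-half^ u k) ⟩
    fromℕ u ℚ.* half^ n                             ∎
    where
    open ℚP.≤-Reasoning
    hh : ℚ.NonNegative (half^ n ℚ.* half^ k)
    hh = ℚP.nonNeg*nonNeg⇒nonNeg (half^ n) {{half^-nonNeg n}} (half^ k) {{half^-nonNeg k}}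

  half^-scale-≡ : ∀ {c k u n} → c * 2 ^ n ≡ 2 ^ k * u → fromℕ c ℚ.* half^ k ≡ fromℕ u ℚ.* half^ n
  half^-scale-≡ {c} {k} {u} {n} c2ⁿ≡2ᵏu = ℚP.≤-antisym (half^-scale-≤ {c} {k} {u} {n} (ℕP.≤-reflexive c2ⁿ≡2ᵏu))
    (half^-scale-≤ {u} {n} {c} {k} (ℕP.≤-reflexive (trans (ℕP.*-comm u (2 ^ k)) (trans (sym c2ⁿ≡2ᵏu) (ℕP.*-comm c (2 ^ n))))))

  sumOver : ∀ {A : Set} → (A → ℚ) → List A → ℚ
  sumOver f xs = sumℚ (List.map f xs)

  module _ {A : Set} where

    sumOver-cong : ∀ {f g : A → ℚ} xs → (∀ x → x ∈ xs → f x ≡ g x) → sumOver f xs ≡ sumOver g xs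
    sumOver-cong [] _ = refl
    sumOver-cong (x ∷ xs) f≗g = cong₂ ℚ._+_ (f≗g x (here refl)) (sumOver-cong xs (λ y → f≗g y ∘ there))

    sumOver-mono-≤ : ∀ {f g : A → ℚ} xs → (∀ x → x ∈ xs → f x ℚ.≤ g x) → sumOver f xs ℚ.≤ sumOver g xs
    sumOver-mono-≤ [] _ = ℚP.≤-refl
    sumOver-mono-≤ (x ∷ xs) f≤g = ℚP.+-mono-≤ (f≤g x (here refl)) (sumOver-mono-≤ xs (λ y → f≤g y ∘ there))

    sumOver-+ : ∀ (f g : A → ℚ) xs → sumOver (λ x → f x ℚ.+ g x) xs ≡ sumOver f xs ℚ.+ sumOver g xs
    sumOver-+ f g [] = refl
    sumOver-+ f g (x ∷ xs) rewrite sumOver-+ f g xs = interchange (f x) (g x) (sumOver f xs) (sumOver g xs)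
      where
      open +-*-Solver
      interchange : ∀ a b c d → (a ℚ.+ b) ℚ.+ (c ℚ.+ d) ≡ (a ℚ.+ c) ℚ.+ (b ℚ.+ d)
      interchange = solve 4 (λ a b c d → (a :+ b) :+ (c :+ d) := (a :+ c) :+ (b :+ d)) refl

    sumOver-*ˡ : ∀ c (f : A → ℚ) xs → sumOver (λ x → c ℚ.* f x) xs ≡ c ℚ.* sumOver f xs
    sumOver-*ˡ c f [] = sym (ℚP.*-zeroʳ c)
    sumOver-*ˡ c f (x ∷ xs) rewrite sumOver-*ˡ c f xs = sym (ℚP.*-distribˡ-+ c (f x) (sumOver f xs))

    sumOver-neg : ∀ (f : A → ℚ) xs → sumOver (λ x → ℚ.- f x) xs ≡ ℚ.- sumOver f xs
    sumOver-neg f [] = refl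
    sumOver-neg f (x ∷ xs) rewrite sumOver-neg f xs = sym (ℚP.neg-distrib-+ (f x) (sumOver f xs))

    sumOver-- : ∀ (f g : A → ℚ) xs → sumOver (λ x → f x ℚ.- g x) xs ≡ sumOver f xs ℚ.- sumOver g xs
    sumOver-- f g xs = trans (sumOver-+ f (λ x → ℚ.- g x) xs) (cong (sumOver f xs ℚ.+_) (sumOver-neg g xs))

    sumOver-++ : ∀ (f : A → ℚ) xs ys → sumOver f (xs ++ ys) ≡ sumOver f xs ℚ.+ sumOver f ys
    sumOver-++ f [] ys = sym (ℚP.+-identityˡ _)
    sumOver-++ f (x ∷ xs) ys rewrite sumOver-++ f xs ys = sym (ℚP.+-assoc (f x) _ _)

    sumOver-zero : ∀ (xs : List A) → sumOver (λ _ → 0ℚ) xs ≡ 0ℚ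
    sumOver-zero [] = refl
    sumOver-zero (x ∷ xs) rewrite sumOver-zero xs = refl

  𝟙 : Bool → ℚ
  𝟙 b = if b then 1ℚ else 0ℚ

  sumOver-𝟙 : ∀ {A : Set} (P : A → Bool) xs → sumOver (λ x → 𝟙 (P x)) xs ≡ fromℕ (count P xs)
  sumOver-𝟙 P [] = refl
  sumOver-𝟙 P (x ∷ xs) with P x
  ... | true rewrite sumOver-𝟙 P xs = sym (fromℕ-suc (count P xs))
  ... | false rewrite sumOver-𝟙 P xs = ℚP.+-identityˡ _

  sumOver-comm : ∀ {A B : Set} (k : A → B → ℚ) xs ys →
    sumOver (λ x → sumOver (k x) ys) xs ≡ sumOver (λ y → sumOver (λ x → k x y) xs) ys
  sumOver-comm k [] ys = sym (sumOver-zero ys)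
  sumOver-comm k (x ∷ xs) ys rewrite sumOver-comm k xs ys = sym (sumOver-+ (k x) (λ y → sumOver (λ x′ → k x′ y) xs) ys)

  sumOver-*-sumOver : ∀ {A B : Set} (f : A → ℚ) (g : B → ℚ) xs ys →
    sumOver f xs ℚ.* sumOver g ys ≡ sumOver (λ x → sumOver (λ y → f x ℚ.* g y) ys) xs
  sumOver-*-sumOver f g [] ys = ℚP.*-zeroˡ (sumOver g ys)
  sumOver-*-sumOver f g (x ∷ xs) ys rewrite sym (sumOver-*-sumOver f g xs ys) | sumOver-*ˡ (f x) g ys =
    ℚP.*-distribʳ-+ (sumOver g ys) (f x) (sumOver f xs)

  sumOver-square : ∀ {A : Set} (g : A → A → ℚ) xs →
    sumOver (λ y → sumOver (g y) xs) xs ≡ sumOver (λ y → g y y) xs ℚ.+ sumOver (uncurry g) (orderedPairs xs)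
  sumOver-square g [] = refl
  sumOver-square g (x ∷ xs) = begin
    (g x x ℚ.+ row) ℚ.+ sumOver (λ y → g y x ℚ.+ sumOver (g y) xs) xs
      ≡⟨ cong ((g x x ℚ.+ row) ℚ.+_) (sumOver-+ (λ y → g y x) (λ y → sumOver (g y) xs) xs) ⟩
    (g x x ℚ.+ row) ℚ.+ (column ℚ.+ sumOver (λ y → sumOver (g y) xs) xs)
      ≡⟨ cong (λ s → (g x x ℚ.+ row) ℚ.+ (column ℚ.+ s)) (sumOver-square g xs) ⟩
    (g x x ℚ.+ row) ℚ.+ (column ℚ.+ (diagonal ℚ.+ rest))
      ≡⟨ regroup (g x x) row column diagonal rest ⟩
    (g x x ℚ.+ diagonal) ℚ.+ ((row ℚ.+ column) ℚ.+ rest)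
      ≡⟨ cong (λ s → (g x x ℚ.+ diagonal) ℚ.+ (s ℚ.+ rest)) (sym cross) ⟩
    (g x x ℚ.+ diagonal) ℚ.+ (sumOver (uncurry g) crossPairs ℚ.+ rest)
      ≡⟨ cong ((g x x ℚ.+ diagonal) ℚ.+_) (sym (sumOver-++ (uncurry g) crossPairs (orderedPairs xs))) ⟩
    (g x x ℚ.+ diagonal) ℚ.+ sumOver (uncurry g) (crossPairs ++ orderedPairs xs) ∎
    where
    open ≡-Reasoning
    open +-*-Solver
    row = sumOver (g x) xs
    column = sumOver (λ y → g y x) xs
    diagonal = sumOver (λ y → g y y) xs
    rest = sumOver (uncurry g) (orderedPairs xs)
    crossPairs = concatMap (λ y → (x , y) ∷ (y , x) ∷ []) xs
    regroup : ∀ a b c d e → (a ℚ.+ b) ℚ.+ (c ℚ.+ (d ℚ.+ e)) ≡ (a ℚ.+ d) ℚ.+ ((b ℚ.+ c) ℚ.+ e)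
    regroup = solve 5 (λ a b c d e → (a :+ b) :+ (c :+ (d :+ e)) := (a :+ d) :+ ((b :+ c) :+ e)) refl
    crossSum : ∀ ys → sumOver (uncurry g) (concatMap (λ y → (x , y) ∷ (y , x) ∷ []) ys) ≡ sumOver (λ y → g x y ℚ.+ g y x) ys
    crossSum [] = refl
    crossSum (y ∷ ys) rewrite crossSum ys = sym (ℚP.+-assoc (g x y) (g y x) _)
    cross : sumOver (uncurry g) crossPairs ≡ row ℚ.+ column
    cross = trans (crossSum xs) (sumOver-+ (g x) (λ y → g y x) xs)

  module _ {n : ℕ} where

    𝔼-cong : ∀ {f g : Assignment n → ℚ} → (∀ a → f a ≡ g a) → 𝔼 n f ≡ 𝔼 n g
    𝔼-cong f≗g = cong (ℚ._* half^ n) (sumOver-cong (allAssignments n) (λ a _ → f≗g a))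

    private
      Σₐ : (Assignment n → ℚ) → ℚ
      Σₐ f = sumOver f (allAssignments n)

    𝔼-+ : ∀ (f g : Assignment n → ℚ) → 𝔼 n (λ a → f a ℚ.+ g a) ≡ 𝔼 n f ℚ.+ 𝔼 n g
    𝔼-+ f g = trans (cong (ℚ._* half^ n) (sumOver-+ f g (allAssignments n))) (ℚP.*-distribʳ-+ (half^ n) (Σₐ f) (Σₐ g))

    𝔼-neg : ∀ (f : Assignment n → ℚ) → 𝔼 n (λ a → ℚ.- f a) ≡ ℚ.- 𝔼 n f
    𝔼-neg f = trans (cong (ℚ._* half^ n) (sumOver-neg f (allAssignments n))) (sym (ℚP.neg-distribˡ-* (Σₐ f) (half^ n)))

    𝔼-- : ∀ (f g : Assignment n → ℚ) → 𝔼 n (λ a → f a ℚ.- g a) ≡ 𝔼 n f ℚ.- 𝔼 n g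
    𝔼-- f g = trans (𝔼-+ f (λ a → ℚ.- g a)) (cong (𝔼 n f ℚ.+_) (𝔼-neg g))

    𝔼-*ˡ : ∀ c (f : Assignment n → ℚ) → 𝔼 n (λ a → c ℚ.* f a) ≡ c ℚ.* 𝔼 n f
    𝔼-*ˡ c f = trans (cong (ℚ._* half^ n) (sumOver-*ˡ c f (allAssignments n))) (ℚP.*-assoc c (Σₐ f) (half^ n))

    𝔼-𝟙 : ∀ (P : Assignment n → Bool) → 𝔼 n (λ a → 𝟙 (P a)) ≡ fromℕ (count P (allAssignments n)) ℚ.* half^ n
    𝔼-𝟙 P = cong (ℚ._* half^ n) (sumOver-𝟙 P (allAssignments n))

    𝔼-const : ∀ c → 𝔼 n (λ _ → c) ≡ c
    𝔼-const c = begin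
      𝔼 n (λ _ → c)                                               ≡⟨ 𝔼-cong (λ _ → sym (ℚP.*-identityʳ c)) ⟩
      𝔼 n (λ _ → c ℚ.* 𝟙 true)                                    ≡⟨ 𝔼-*ˡ c (λ _ → 1ℚ) ⟩
      c ℚ.* 𝔼 n (λ _ → 𝟙 true)                                    ≡⟨ cong (c ℚ.*_) (𝔼-𝟙 (λ _ → true)) ⟩
      c ℚ.* (fromℕ (count (λ _ → true) (allAssignments n)) ℚ.* half^ n)
        ≡⟨ cong (λ k → c ℚ.* (fromℕ k ℚ.* half^ n)) (trans (count-allAssignments-true n) (sym (ℕP.*-identityˡ (2 ^ n)))) ⟩
      c ℚ.* (fromℕ (1 * 2 ^ n) ℚ.* half^ n)                        ≡⟨ cong (c ℚ.*_) (fromℕ-*-2^-half^ 1 n) ⟩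
      c ℚ.* 1ℚ                                                    ≡⟨ ℚP.*-identityʳ c ⟩
      c                                                           ∎
      where open ≡-Reasoning

    𝔼-sumOver : ∀ {A : Set} (g : A → Assignment n → ℚ) zs →
      𝔼 n (λ a → sumOver (λ z → g z a) zs) ≡ sumOver (λ z → 𝔼 n (g z)) zs
    𝔼-sumOver g zs = begin
      sumOver (λ a → sumOver (λ z → g z a) zs) (allAssignments n) ℚ.* half^ n
        ≡⟨ cong (ℚ._* half^ n) (sumOver-comm (λ a z → g z a) (allAssignments n) zs) ⟩
      sumOver (λ z → sumOver (g z) (allAssignments n)) zs ℚ.* half^ n
        ≡⟨ ℚP.*-comm _ (half^ n) ⟩
      half^ n ℚ.* sumOver (λ z → sumOver (g z) (allAssignments n)) zs
        ≡⟨ sym (sumOver-*ˡ (half^ n) (λ z → sumOver (g z) (allAssignments n)) zs) ⟩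
      sumOver (λ z → half^ n ℚ.* sumOver (g z) (allAssignments n)) zs
        ≡⟨ sumOver-cong zs (λ z _ → ℚP.*-comm (half^ n) _) ⟩
      sumOver (λ z → 𝔼 n (g z)) zs ∎
      where open ≡-Reasoning

  falsifyProb : ∀ n → Clause n → ℚ
  falsifyProb n L = 𝔼 n (λ a → 𝟙 (not (clauseSat a L)))

  falsifyProb≡ : ∀ n (L : Clause n) → falsifyProb n L ≡ fromℕ (falsifiers n L) ℚ.* half^ n
  falsifyProb≡ n L = 𝔼-𝟙 (λ a → not (clauseSat a L))

  falsifyProb-exactClause : ∀ {r n} {Y : Clause n} → ExactClause r Y → falsifyProb n Y ≡ half^ r
  falsifyProb-exactClause {r} {n} {Y} exactY = begin
    falsifyProb n Y                   ≡⟨ falsifyProb≡ n Y ⟩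
    fromℕ (falsifiers n Y) ℚ.* half^ n
      ≡⟨ sym (half^-scale-≡ {1} {r} {falsifiers n Y} {n} (trans (ℕP.*-identityˡ (2 ^ n)) (sym (falsifiers-exactClause exactY)))) ⟩
    fromℕ 1 ℚ.* half^ r               ≡⟨ ℚP.*-identityˡ (half^ r) ⟩
    half^ r                           ∎
    where open ≡-Reasoning

  half^-+ : ∀ a b → half^ (a + b) ≡ half^ a ℚ.* half^ b
  half^-+ zero b = sym (ℚP.*-identityˡ (half^ b))
  half^-+ (suc a) b rewrite half^-+ a b = sym (ℚP.*-assoc ½ (half^ a) (half^ b))

  falsifyProb-++-self : ∀ n (Y : Clause n) → falsifyProb n (Y ++ Y) ≡ falsifyProb n Y
  falsifyProb-++-self n Y = trans (falsifyProb≡ n (Y ++ Y))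
    (trans (cong (λ k → fromℕ k ℚ.* half^ n) (falsifiers-++-self n Y)) (sym (falsifyProb≡ n Y)))

  falsifyProb-conflict : ∀ n {Y Z : Clause n} → Conflict Y Z → falsifyProb n (Y ++ Z) ≡ 0ℚ
  falsifyProb-conflict n {Y} {Z} conflict = trans (falsifyProb≡ n (Y ++ Z))
    (trans (cong (λ k → fromℕ k ℚ.* half^ n) (falsifiers-conflict n conflict)) (ℚP.*-zeroˡ (half^ n)))

  clauseSat-++ : ∀ {n} (a : Assignment n) Y Z → clauseSat a (Y ++ Z) ≡ clauseSat a Y ∨ clauseSat a Z
  clauseSat-++ a [] Z = refl
  clauseSat-++ a (p ∷ Y) Z rewrite clauseSat-++ a Y Z = sym (BoolP.∨-assoc (litSat a p) _ _)

  XZ-*-XZ : ∀ h s t → (if s then h else h ℚ.- 1ℚ) ℚ.* (if t then h else h ℚ.- 1ℚ) ≡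
    (h ℚ.* h ℚ.+ 𝟙 (not (s ∨ t))) ℚ.- h ℚ.* (𝟙 (not s) ℚ.+ 𝟙 (not t))
  XZ-*-XZ h true true = solve 1 (λ h → h :* h := (h :* h :+ con 0ℚ) :- h :* (con 0ℚ :+ con 0ℚ)) refl h
    where open +-*-Solver
  XZ-*-XZ h true false = solve 1 (λ h → h :* (h :- con 1ℚ) := (h :* h :+ con 0ℚ) :- h :* (con 0ℚ :+ con 1ℚ)) refl h
    where open +-*-Solver
  XZ-*-XZ h false true = solve 1 (λ h → (h :- con 1ℚ) :* h := (h :* h :+ con 0ℚ) :- h :* (con 1ℚ :+ con 0ℚ)) refl h
    where open +-*-Solver
  XZ-*-XZ h false false = solve 1 (λ h → (h :- con 1ℚ) :* (h :- con 1ℚ) := (h :* h :+ con 1ℚ) :- h :* (con 1ℚ :+ con 1ℚ)) refl h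
    where open +-*-Solver

  module _ {r n : ℕ} {Y Z : Clause n} (exactY : ExactClause r Y) (exactZ : ExactClause r Z) where

    private
      hh : ℚ
      hh = half^ r ℚ.* half^ r

      conflicting : Conflict Y Z → hh ℚ.* (0ℚ ℚ.- 1ℚ) ℚ.≤ falsifyProb n (Y ++ Z) ℚ.- hh
      conflicting conflict = ℚP.≤-reflexive (begin
        hh ℚ.* (0ℚ ℚ.- 1ℚ)  ≡⟨ solve 1 (λ x → x :* (con 0ℚ :- con 1ℚ) := con 0ℚ :- x) refl hh ⟩
        0ℚ ℚ.- hh           ≡⟨ cong (ℚ._- hh) (sym (falsifyProb-conflict n conflict)) ⟩
        falsifyProb n (Y ++ Z) ℚ.- hh ∎)
        where
        open ≡-Reasoning
        open +-*-Solver

      from-count : ∀ c → c * 2 ^ n ≤ 2 ^ (r + r) * falsifiers n (Y ++ Z) →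
        fromℕ c ℚ.* (half^ r ℚ.* half^ r) ℚ.≤ falsifyProb n (Y ++ Z)
      from-count c bound = subst₂ ℚ._≤_ (cong (fromℕ c ℚ.*_) (half^-+ r r)) (sym (falsifyProb≡ n (Y ++ Z)))
        (half^-scale-≤ {c} {r + r} {falsifiers n (Y ++ Z)} {n} bound)

    falsifyProb-noConflict : ¬ Conflict Y Z → half^ r ℚ.* half^ r ℚ.≤ falsifyProb n (Y ++ Z)
    falsifyProb-noConflict noConflict = subst (ℚ._≤ falsifyProb n (Y ++ Z)) (ℚP.*-identityˡ _)
      (from-count 1 (subst (ℕ._≤ 2 ^ (r + r) * falsifiers n (Y ++ Z)) (sym (ℕP.*-identityˡ (2 ^ n)))
        (falsifiers-noConflict exactY exactZ noConflict)))

    falsifyProb-overlap : Overlap Y Z → fromℕ 2 ℚ.* (half^ r ℚ.* half^ r) ℚ.≤ falsifyProb n (Y ++ Z)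
    falsifyProb-overlap shared = from-count 2 (falsifiers-overlap exactY exactZ shared)

    𝔼-XZ-*-XZ : 𝔼 n (λ a → XZ r Y a ℚ.* XZ r Z a) ≡ falsifyProb n (Y ++ Z) ℚ.- half^ r ℚ.* half^ r
    𝔼-XZ-*-XZ = begin
      𝔼 n (λ a → XZ r Y a ℚ.* XZ r Z a)
        ≡⟨ 𝔼-cong pointwise ⟩
      𝔼 n (λ a → (h ℚ.* h ℚ.+ falsified (Y ++ Z) a) ℚ.- h ℚ.* (falsified Y a ℚ.+ falsified Z a))
        ≡⟨ 𝔼-- (λ a → h ℚ.* h ℚ.+ falsified (Y ++ Z) a) (λ a → h ℚ.* (falsified Y a ℚ.+ falsified Z a)) ⟩
      𝔼 n (λ a → h ℚ.* h ℚ.+ falsified (Y ++ Z) a) ℚ.- 𝔼 n (λ a → h ℚ.* (falsified Y a ℚ.+ falsified Z a))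
        ≡⟨ cong₂ ℚ._-_ (trans (𝔼-+ (λ _ → h ℚ.* h) (falsified (Y ++ Z))) (cong (ℚ._+ falsifyProb n (Y ++ Z)) (𝔼-const {n} (h ℚ.* h))))
                       (trans (𝔼-*ˡ h (λ a → falsified Y a ℚ.+ falsified Z a)) (cong (h ℚ.*_) (𝔼-+ (falsified Y) (falsified Z)))) ⟩
      (h ℚ.* h ℚ.+ falsifyProb n (Y ++ Z)) ℚ.- h ℚ.* (falsifyProb n Y ℚ.+ falsifyProb n Z)
        ≡⟨ cong (λ q → (h ℚ.* h ℚ.+ falsifyProb n (Y ++ Z)) ℚ.- h ℚ.* q)
                (cong₂ ℚ._+_ (falsifyProb-exactClause exactY) (falsifyProb-exactClause exactZ)) ⟩
      (h ℚ.* h ℚ.+ falsifyProb n (Y ++ Z)) ℚ.- h ℚ.* (h ℚ.+ h)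
        ≡⟨ simplify h (falsifyProb n (Y ++ Z)) ⟩
      falsifyProb n (Y ++ Z) ℚ.- h ℚ.* h ∎
      where
      open ≡-Reasoning
      open +-*-Solver
      h = half^ r
      falsified : Clause n → Assignment n → ℚ
      falsified L a = 𝟙 (not (clauseSat a L))
      pointwise : ∀ a → XZ r Y a ℚ.* XZ r Z a ≡
        (h ℚ.* h ℚ.+ falsified (Y ++ Z) a) ℚ.- h ℚ.* (falsified Y a ℚ.+ falsified Z a)
      pointwise a rewrite clauseSat-++ a Y Z = XZ-*-XZ h (clauseSat a Y) (clauseSat a Z)
      simplify : ∀ h p → (h ℚ.* h ℚ.+ p) ℚ.- h ℚ.* (h ℚ.+ h) ≡ p ℚ.- h ℚ.* h
      simplify = solve 2 (λ h p → (h :* h :+ p) :- h :* (h :+ h) := p :- h :* h) refl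

    pairWeight-lower : half^ r ℚ.* half^ r ℚ.* (𝟙 ⌊ overlap? Y Z ⌋ ℚ.- 𝟙 ⌊ conflict? Y Z ⌋) ℚ.≤
      falsifyProb n (Y ++ Z) ℚ.- half^ r ℚ.* half^ r
    -- ⌊ overlap? Y Z ⌋ only computes once both of its components are decided.
    pairWeight-lower with any? (_∈?ᴸ Z) Y | conflict? Y Z
    ... | yes _ | yes conflict = conflicting conflict
    ... | no _ | yes conflict = conflicting conflict
    ... | yes shared | no noConflict = begin
      hh ℚ.* (1ℚ ℚ.- 0ℚ)        ≡⟨ solve 1 (λ x → x :* (con 1ℚ :- con 0ℚ) := (con 1ℚ :+ con 1ℚ) :* x :- x) refl hh ⟩
      (1ℚ ℚ.+ 1ℚ) ℚ.* hh ℚ.- hh ≡⟨ cong (λ t → t ℚ.* hh ℚ.- hh) (sym (fromℕ-suc 1)) ⟩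
      fromℕ 2 ℚ.* hh ℚ.- hh     ≤⟨ ℚP.+-monoˡ-≤ (ℚ.- hh) (falsifyProb-overlap (shared , noConflict)) ⟩
      falsifyProb n (Y ++ Z) ℚ.- hh ∎
      where
      open ℚP.≤-Reasoning
      open +-*-Solver
    ... | no _ | no noConflict = begin
      hh ℚ.* (0ℚ ℚ.- 0ℚ) ≡⟨ solve 1 (λ x → x :* (con 0ℚ :- con 0ℚ) := x :- x) refl hh ⟩
      hh ℚ.- hh          ≤⟨ ℚP.+-monoˡ-≤ (ℚ.- hh) (falsifyProb-noConflict noConflict) ⟩
      falsifyProb n (Y ++ Z) ℚ.- hh ∎
      where
      open ℚP.≤-Reasoning
      open +-*-Solver

  sumOver-const : ∀ {A : Set} c (xs : List A) → sumOver (λ _ → c) xs ≡ fromℕ (length xs) ℚ.* c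
  sumOver-const c [] = sym (ℚP.*-zeroˡ c)
  sumOver-const c (x ∷ xs) rewrite sumOver-const c xs | fromℕ-suc (length xs) =
    sym (trans (ℚP.*-distribʳ-+ c 1ℚ (fromℕ (length xs))) (cong (ℚ._+ fromℕ (length xs) ℚ.* c) (ℚP.*-identityˡ c)))

  𝔼-X² : ∀ r n (C : List (Clause n)) →
    𝔼 n (λ a → X r C a ℚ.* X r C a) ≡ sumOver (λ Y → sumOver (λ Z → 𝔼 n (λ a → XZ r Y a ℚ.* XZ r Z a)) C) C
  𝔼-X² r n C = begin
    𝔼 n (λ a → X r C a ℚ.* X r C a)
      ≡⟨ 𝔼-cong (λ a → sumOver-*-sumOver (λ Y → XZ r Y a) (λ Z → XZ r Z a) C C) ⟩
    𝔼 n (λ a → sumOver (λ Y → sumOver (λ Z → XZ r Y a ℚ.* XZ r Z a) C) C)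
      ≡⟨ 𝔼-sumOver (λ Y a → sumOver (λ Z → XZ r Y a ℚ.* XZ r Z a) C) C ⟩
    sumOver (λ Y → 𝔼 n (λ a → sumOver (λ Z → XZ r Y a ℚ.* XZ r Z a) C)) C
      ≡⟨ sumOver-cong C (λ Y _ → 𝔼-sumOver (λ Z a → XZ r Y a ℚ.* XZ r Z a) C) ⟩
    sumOver (λ Y → sumOver (λ Z → 𝔼 n (λ a → XZ r Y a ℚ.* XZ r Z a)) C) C ∎
    where open ≡-Reasoning

  𝔼-X²-lower : ∀ r n (C : List (Clause n)) → (∀ Y → Y ∈ C → ExactClause r Y) →
    let h = half^ r in
    fromℕ (length C) ℚ.* (h ℚ.- h ℚ.* h) ℚ.+ h ℚ.* h ℚ.* (fromℕ (overlapCount C) ℚ.- fromℕ (conflictCount C))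
      ℚ.≤ 𝔼 n (λ a → X r C a ℚ.* X r C a)
  𝔼-X²-lower r n C exact = begin
    fromℕ (length C) ℚ.* (h ℚ.- hh) ℚ.+ hh ℚ.* (fromℕ (overlapCount C) ℚ.- fromℕ (conflictCount C))
      ≡⟨ cong₂ ℚ._+_ (sym diagonal) (sym offDiagonal) ⟩
    sumOver (λ Y → E Y Y) C ℚ.+ sumOver (λ p → hh ℚ.* (𝟙 (overlaps p) ℚ.- 𝟙 (conflicts p))) pairs
      ≤⟨ ℚP.+-monoʳ-≤ (sumOver (λ Y → E Y Y) C) (sumOver-mono-≤ pairs pairBound) ⟩
    sumOver (λ Y → E Y Y) C ℚ.+ sumOver (uncurry E) pairs
      ≡⟨ sym (sumOver-square E C) ⟩
    sumOver (λ Y → sumOver (E Y) C) C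
      ≡⟨ sym (𝔼-X² r n C) ⟩
    𝔼 n (λ a → X r C a ℚ.* X r C a) ∎
    where
    open ℚP.≤-Reasoning
    h = half^ r
    hh = h ℚ.* h
    pairs = orderedPairs C
    E : Clause n → Clause n → ℚ
    E Y Z = 𝔼 n (λ a → XZ r Y a ℚ.* XZ r Z a)
    overlaps conflicts : Clause n × Clause n → Bool
    overlaps (Y , Z) = ⌊ overlap? Y Z ⌋
    conflicts (Y , Z) = ⌊ conflict? Y Z ⌋
    diagonal : sumOver (λ Y → E Y Y) C ≡ fromℕ (length C) ℚ.* (h ℚ.- hh)
    diagonal = trans
      (sumOver-cong C (λ Y Y∈C → trans (𝔼-XZ-*-XZ (exact Y Y∈C) (exact Y Y∈C))
        (cong (ℚ._- hh) (trans (falsifyProb-++-self n Y) (falsifyProb-exactClause (exact Y Y∈C))))))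
      (sumOver-const (h ℚ.- hh) C)
    offDiagonal : sumOver (λ p → hh ℚ.* (𝟙 (overlaps p) ℚ.- 𝟙 (conflicts p))) pairs ≡
      hh ℚ.* (fromℕ (overlapCount C) ℚ.- fromℕ (conflictCount C))
    offDiagonal = begin-equality
      sumOver (λ p → hh ℚ.* (𝟙 (overlaps p) ℚ.- 𝟙 (conflicts p))) pairs
        ≡⟨ sumOver-*ˡ hh (λ p → 𝟙 (overlaps p) ℚ.- 𝟙 (conflicts p)) pairs ⟩
      hh ℚ.* sumOver (λ p → 𝟙 (overlaps p) ℚ.- 𝟙 (conflicts p)) pairs
        ≡⟨ cong (hh ℚ.*_) (trans (sumOver-- (𝟙 ∘ overlaps) (𝟙 ∘ conflicts) pairs)
                                  (cong₂ ℚ._-_ (sumOver-𝟙 overlaps pairs) (sumOver-𝟙 conflicts pairs))) ⟩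
      hh ℚ.* (fromℕ (overlapCount C) ℚ.- fromℕ (conflictCount C)) ∎
    pairBound : ∀ p → p ∈ pairs → hh ℚ.* (𝟙 (overlaps p) ℚ.- 𝟙 (conflicts p)) ℚ.≤ uncurry E p
    pairBound (Y , Z) p∈ =
      subst (hh ℚ.* (𝟙 (overlaps (Y , Z)) ℚ.- 𝟙 (conflicts (Y , Z))) ℚ.≤_) (sym (𝔼-XZ-*-XZ exactY exactZ))
        (pairWeight-lower exactY exactZ)
      where
      exactY = exact Y (proj₁ (∈-orderedPairs⁻ C p∈))
      exactZ = exact Z (proj₂ (∈-orderedPairs⁻ C p∈))

  cn-bound-ℚ : ∀ r {n} (C : List (Clause n)) → 2 ≤ r → cn C ℤ.≤ pos (2 ^ r ∸ 2) ℤ.* pos (length C) →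
    fromℕ (conflictCount C) ℚ.≤ fromℕ (overlapCount C) ℚ.+ (fromℕ (2 ^ r) ℚ.- fromℕ 2) ℚ.* fromℕ (length C)
  cn-bound-ℚ r C 2≤r bound = begin
    fromℕ c                                  ≤⟨ fromℕ-mono-≤ (m-n≤o⇒m≤n+o c o (k * m) (subst (cn C ℤ.≤_) (sym (ℤP.pos-* k m)) bound)) ⟩
    fromℕ (o + k * m)                        ≡⟨ fromℕ-+ o (k * m) ⟩
    fromℕ o ℚ.+ fromℕ (k * m)                ≡⟨ cong (fromℕ o ℚ.+_) (fromℕ-* k m) ⟩
    fromℕ o ℚ.+ fromℕ k ℚ.* fromℕ m          ≡⟨ cong (λ x → fromℕ o ℚ.+ x ℚ.* fromℕ m) (fromℕ-∸ 2≤2^r) ⟩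
    fromℕ o ℚ.+ (fromℕ (2 ^ r) ℚ.- fromℕ 2) ℚ.* fromℕ m ∎
    where
    open ℚP.≤-Reasoning
    c = conflictCount C
    o = overlapCount C
    k = 2 ^ r ∸ 2
    m = length C
    2≤2^r : 2 ≤ 2 ^ r
    2≤2^r = ℕP.≤-trans (2≤2^suc 0) (ℕP.^-monoʳ-≤ 2 (ℕP.≤-trans (s≤s z≤n) 2≤r))

  diagonal-pays-for-conflicts : ∀ h K m o → h ℚ.* K ≡ 1ℚ →
    m ℚ.* (h ℚ.* h) ≡ m ℚ.* (h ℚ.- h ℚ.* h) ℚ.+ h ℚ.* h ℚ.* (o ℚ.- (o ℚ.+ (K ℚ.- fromℕ 2) ℚ.* m))
  diagonal-pays-for-conflicts h K m o hK≡1 = begin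
    m ℚ.* (h ℚ.* h)                                 ≡⟨ solve 3 (λ m h k → m :* (h :* h) := m :* (h :* h) :+ m :* h :* (k :- k)) refl m h 1ℚ ⟩
    m ℚ.* (h ℚ.* h) ℚ.+ m ℚ.* h ℚ.* (1ℚ ℚ.- 1ℚ)     ≡⟨ cong (λ x → m ℚ.* (h ℚ.* h) ℚ.+ m ℚ.* h ℚ.* (1ℚ ℚ.- x)) (sym hK≡1) ⟩
    m ℚ.* (h ℚ.* h) ℚ.+ m ℚ.* h ℚ.* (1ℚ ℚ.- h ℚ.* K)
      ≡⟨ solve 4 (λ h k m o → m :* (h :* h) :+ m :* h :* (con 1ℚ :- h :* k)
                            := m :* (h :- h :* h) :+ h :* h :* (o :- (o :+ (k :- (con 1ℚ :+ con 1ℚ)) :* m))) refl h K m o ⟩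
    m ℚ.* (h ℚ.- h ℚ.* h) ℚ.+ h ℚ.* h ℚ.* (o ℚ.- (o ℚ.+ (K ℚ.- (1ℚ ℚ.+ 1ℚ)) ℚ.* m))
      ≡⟨ cong (λ t → m ℚ.* (h ℚ.- h ℚ.* h) ℚ.+ h ℚ.* h ℚ.* (o ℚ.- (o ℚ.+ (K ℚ.- t) ℚ.* m))) (sym (fromℕ-suc 1)) ⟩
    m ℚ.* (h ℚ.- h ℚ.* h) ℚ.+ h ℚ.* h ℚ.* (o ℚ.- (o ℚ.+ (K ℚ.- fromℕ 2) ℚ.* m)) ∎
    where
    open ≡-Reasoning
    open +-*-Solver

open import Defs
open import Data.Nat using (ℕ; _≤_; _^_; _∸_)
open import Data.List using (List; length)
open import Data.Integer using (+_) renaming (_≤_ to _≤ℤ_; _*_ to _*ℤ_)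
open import Data.Rational using (NonNegative; _*_; _/_; _+_; _-_) renaming (_≤_ to _≤ℚ_)
open import Data.Product using (_,_)
import Data.Rational.Properties as ℚP
open SecondMoment

lemma9 : (r n : ℕ) → 2 ≤ r → (C : List (Clause n)) → ExactCNF r C →
    cn C ≤ℤ (+ (2 ^ r ∸ 2)) *ℤ (+ length C) →
    (+ length C / 1) * (half^ r * half^ r) ≤ℚ 𝔼 n (λ a → X r C a * X r C a)
-- The clauses of C need not be distinct: a repeated clause only contributes an overlapping pair.
lemma9 r n 2≤r C (_ , exact) bound = begin
  m * (h * h)
    ≡⟨ diagonal-pays-for-conflicts h (fromℕ (2 ^ r)) m o (half^-*-2^ r) ⟩
  m * (h - h * h) + h * h * (o - (o + (fromℕ (2 ^ r) - fromℕ 2) * m))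
    ≤⟨ ℚP.+-monoʳ-≤ (m * (h - h * h)) (ℚP.*-monoˡ-≤-nonNeg (h * h) {{hh-nonNeg}}
         (ℚP.+-monoʳ-≤ o (ℚP.neg-antimono-≤ (cn-bound-ℚ r C 2≤r bound)))) ⟩
  m * (h - h * h) + h * h * (o - fromℕ (conflictCount C))
    ≤⟨ 𝔼-X²-lower r n C exact ⟩
  𝔼 n (λ a → X r C a * X r C a) ∎
  where
  open ℚP.≤-Reasoning
  h = half^ r
  m = fromℕ (length C)
  o = fromℕ (overlapCount C)
  hh-nonNeg : NonNegative (h * h)
  hh-nonNeg = ℚP.nonNeg*nonNeg⇒nonNeg h {{half^-nonNeg r}} h {{half^-nonNeg r}}
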